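{- Let $G$ be a finite simple connected graph satisfying property (P2). For any $c_1,c_2\in V(G)$, if $N[c_1]\subseteq N[c_2]$ and $c_1\in N(c,x)$ for some $c,x\in V(G)$ with $d(c,x)\ge 2$, then $c_2\in C(c,x)$, where $C(c,x)=\{u\in N(c,x): N[u]\supseteq N[v]\text{ for all }v\in N(c,x)\}$.
   Context: $d$ is the distance in $G$, $N(x)$ the neighbourhood, $N[x]=N(x)\cup\{x\}$. For $d(c,x)\ge 2$, $N(c,x)=\{v\in N(c): d(c,x)=1+d(v,x)\}$. Property (P2): for any $c,x,y\in V(G)$ and any $c'\in N(c,x)$ with $d(c,x)\ge 2$ and $d(c',y)\ge 2$, either $d(c,y)=d(c,c')+d(c',y)$ or $d(x,y)=d(x,c')+d(c',y)$. (Here $C(c,x)$ is the set defined for property (P3) with the witnessing subgraph $R=G$.) -}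

module Defs where

open import Data.Nat using (ℕ; zero; suc; _+_; _≤_)
open import Data.Fin using (Fin)
open import Data.Product using (_×_; Σ)
open import Data.Sum using (_⊎_)
open import Data.Empty using (⊥)
open import Relation.Nullary using (¬_; Dec)
open import Relation.Binary.PropositionalEquality using (_≡_)

record Graph (n : ℕ) : Set₁ where
  field
    Adj     : Fin n → Fin n → Set
    adj?    : (u v : Fin n) → Dec (Adj u v)
    sym     : ∀ {u v} → Adj u v → Adj v u
    irrefl  : ∀ {u} → ¬ Adj u u

module _ {n : ℕ} (G : Graph n) where
  open Graph G

  data Walk : Fin n → Fin n → ℕ → Set where
    nil  : ∀ {u} → Walk u u 0
    cons : ∀ {u w v k} → Adj u w → Walk w v k → Walk u v (suc k)

  Connected : Set
  Connected = ∀ u v → Σ ℕ (λ k → Walk u v k)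

  IsDistance : Fin n → Fin n → ℕ → Set
  IsDistance u v k = Walk u v k × (∀ m → Walk u v m → k ≤ m)

  IsDistFun : (Fin n → Fin n → ℕ) → Set
  IsDistFun d = ∀ u v → IsDistance u v (d u v)

  InN : Fin n → Fin n → Set
  InN x u = Adj x u

  InN[] : Fin n → Fin n → Set
  InN[] x u = u ≡ x ⊎ Adj x u

  ClosedNbhdSub : Fin n → Fin n → Set
  ClosedNbhdSub a b = ∀ u → InN[] a u → InN[] b u

  module _ (d : Fin n → Fin n → ℕ) where
    InNcx : Fin n → Fin n → Fin n → Set
    InNcx c x v = InN c v × d c x ≡ suc (d v x)

    InC : Fin n → Fin n → Fin n → Set
    InC c x u = InNcx c x u × (∀ v → InNcx c x v → ClosedNbhdSub v u)

    P2 : Set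
    P2 = ∀ c x y c' → 2 ≤ d c x → InNcx c x c' → 2 ≤ d c' y →
         (d c y ≡ d c c' + d c' y) ⊎ (d x y ≡ d x c' + d c' y)

module Submission where

open import Defs
open import Data.Nat using (ℕ; zero; suc; _+_; _≤_; _<_; _≤?_; z≤n; s≤s; s≤s⁻¹)
open import Data.Nat.Properties
open import Data.Fin using (Fin)
open import Data.Product using (_,_; proj₁; proj₂)
open import Data.Sum using (inj₁; inj₂)
open import Relation.Nullary using (yes; no; contradiction)
open import Relation.Binary.PropositionalEquality

-- A neighbour of c₁ on a geodesic to x lies in N[c₂], so c₂ is strictly
-- closer to x than c; as c ∈ N[c₁] ⊆ N[c₂], this puts c₂ in N(c,x).
-- Under (P2) any two members v, w of N(c,x) satisfy N[v] ⊆ N[w]: for u ∈ N[v]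
-- with d(w,u) ≥ 2, (P2) puts w on a geodesic from c or from x to u, giving
-- d(c,u) ≥ 3 or d(x,u) ≥ d(x,w) + 2, whereas u ∈ N[v] forces d(c,u) ≤ 2 and
-- d(x,u) ≤ d(x,w) + 1.

module Walks {n : ℕ} (G : Graph n) where
  open Graph G renaming (sym to Adj-sym)

  walk-snoc : ∀ {u v w k} → Walk G u v k → Adj v w → Walk G u w (suc k)
  walk-snoc nil        vw = cons vw nil
  walk-snoc (cons a p) vw = cons a (walk-snoc p vw)

  walk-reverse : ∀ {u v k} → Walk G u v k → Walk G v u k
  walk-reverse nil        = nil
  walk-reverse (cons a p) = walk-snoc (walk-reverse p) (Adj-sym a)

  walk₀⇒≡ : ∀ {u v} → Walk G u v 0 → u ≡ v
  walk₀⇒≡ nil = refl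

  walk₁⇒Adj : ∀ {u v} → Walk G u v 1 → Adj u v
  walk₁⇒Adj (cons a nil) = a

module Distance {n : ℕ} (G : Graph n) (d : Fin n → Fin n → ℕ) (isD : IsDistFun G d) where
  open Graph G renaming (sym to Adj-sym)
  open Walks G

  geodesic : ∀ u v → Walk G u v (d u v)
  geodesic u v = proj₁ (isD u v)

  dist≤walk : ∀ {u v k} → Walk G u v k → d u v ≤ k
  dist≤walk {u} {v} {k} = proj₂ (isD u v) k

  dist-sym : ∀ u v → d u v ≡ d v u
  dist-sym u v = ≤-antisym (dist≤walk (walk-reverse (geodesic v u)))
                           (dist≤walk (walk-reverse (geodesic u v)))

  dist≡0⇒≡ : ∀ {u v} → d u v ≡ 0 → u ≡ v
  dist≡0⇒≡ {u} {v} eq = walk₀⇒≡ (subst (Walk G u v) eq (geodesic u v))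

  dist≤1⇒InN[] : ∀ {u v} → d u v ≤ 1 → InN[] G u v
  dist≤1⇒InN[] {u} {v} le with d u v in eq
  ... | zero        = inj₁ (sym (dist≡0⇒≡ eq))
  ... | suc zero    = inj₂ (walk₁⇒Adj (subst (Walk G u v) eq (geodesic u v)))
  ... | suc (suc _) = contradiction le λ { (s≤s ()) }

  Adj⇒dist≥1 : ∀ {u v} → Adj u v → 1 ≤ d u v
  Adj⇒dist≥1 {u} {v} a with d u v in eq
  ... | zero  = contradiction (subst (Adj u) (sym (dist≡0⇒≡ eq)) a) irrefl
  ... | suc _ = s≤s z≤n

  InN[]⇒dist≤ˡ : ∀ {u v} x → InN[] G u v → d u x ≤ suc (d v x)
  InN[]⇒dist≤ˡ x (inj₁ refl) = n≤1+n _
  InN[]⇒dist≤ˡ x (inj₂ uv)   = dist≤walk (cons uv (geodesic _ x))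

  InN[]⇒dist≤ʳ : ∀ {u v} x → InN[] G u v → d x v ≤ suc (d x u)
  InN[]⇒dist≤ʳ x (inj₁ refl) = n≤1+n _
  InN[]⇒dist≤ʳ x (inj₂ uv)   = dist≤walk (walk-snoc (geodesic x _) uv)

  ClosedNbhdSub⇒dist≤ : ∀ {a b x} → ClosedNbhdSub G a b → 1 ≤ d a x → d b x ≤ d a x
  ClosedNbhdSub⇒dist≤ {a} {x = x} sub pos with d a x | geodesic a x
  ... | suc m | cons {w = w} aw q =
    ≤-trans (InN[]⇒dist≤ˡ x (sub w (inj₂ aw))) (s≤s (dist≤walk q))

  InNcx-ClosedNbhdSub : ∀ {c x c₁ c₂} → 2 ≤ d c x → InNcx G d c x c₁ →
                        ClosedNbhdSub G c₁ c₂ → InNcx G d c x c₂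
  InNcx-ClosedNbhdSub {c} {x} {c₁} {c₂} 2≤dcx (cc₁ , dcx≡) sub =
    cc₂ , ≤-antisym (InN[]⇒dist≤ˡ x (inj₂ cc₂)) closer
    where
      c∈N[c₂] : InN[] G c₂ c
      c∈N[c₂] = sub c (inj₂ (Adj-sym cc₁))

      closer : d c₂ x < d c x
      closer = subst (d c₂ x <_) (sym dcx≡)
        (s≤s (ClosedNbhdSub⇒dist≤ sub (s≤s⁻¹ (subst (2 ≤_) dcx≡ 2≤dcx))))

      cc₂ : Adj c c₂
      cc₂ with c∈N[c₂]
      ... | inj₁ c≡c₂ = contradiction closer (<-irrefl (cong (λ v → d v x) (sym c≡c₂)))
      ... | inj₂ c₂c  = Adj-sym c₂c

  P2⇒InNcx-ClosedNbhdSub : P2 G d → ∀ {c x v w} → 2 ≤ d c x →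
                           InNcx G d c x v → InNcx G d c x w → ClosedNbhdSub G v w
  P2⇒InNcx-ClosedNbhdSub p2 {c} {x} {v} {w} 2≤dcx (cv , dcx≡v) w∈Ncx u u∈N[v]
    with d w u ≤? 1
  ... | yes dwu≤1 = dist≤1⇒InN[] dwu≤1
  ... | no  dwu≰1 with p2 c x u w 2≤dcx w∈Ncx (≰⇒> dwu≰1)
  ... | inj₁ through-c = contradiction 3≤2 λ { (s≤s (s≤s ())) }
    where
      open ≤-Reasoning
      3≤2 : 3 ≤ 2
      3≤2 = begin
        1 + 2           ≤⟨ +-mono-≤ (Adj⇒dist≥1 (proj₁ w∈Ncx)) (≰⇒> dwu≰1) ⟩
        d c w + d w u   ≡⟨ sym through-c ⟩
        d c u           ≤⟨ InN[]⇒dist≤ʳ c u∈N[v] ⟩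
        suc (d c v)     ≤⟨ s≤s (dist≤walk (cons cv nil)) ⟩
        2               ∎
  ... | inj₂ through-x = contradiction (+-cancelˡ-≤ (d x w) 2 1 2≤1) λ { (s≤s ()) }
    where
      dxv≡dxw : d x v ≡ d x w
      dxv≡dxw = begin
        d x v   ≡⟨ dist-sym x v ⟩
        d v x   ≡⟨ suc-injective (trans (sym dcx≡v) (proj₂ w∈Ncx)) ⟩
        d w x   ≡⟨ dist-sym w x ⟩
        d x w   ∎
        where open ≡-Reasoning
      open ≤-Reasoning
      2≤1 : d x w + 2 ≤ d x w + 1
      2≤1 = begin
        d x w + 2       ≤⟨ +-monoʳ-≤ (d x w) (≰⇒> dwu≰1) ⟩
        d x w + d w u   ≡⟨ sym through-x ⟩
        d x u           ≤⟨ InN[]⇒dist≤ʳ x u∈N[v] ⟩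
        suc (d x v)     ≡⟨ cong suc dxv≡dxw ⟩
        suc (d x w)     ≡⟨ +-comm 1 (d x w) ⟩
        d x w + 1       ∎

  P2⇒InNcx⇒InC : P2 G d → ∀ {c x w} → 2 ≤ d c x → InNcx G d c x w → InC G d c x w
  P2⇒InNcx⇒InC p2 2≤dcx w∈Ncx =
    w∈Ncx , λ v v∈Ncx → P2⇒InNcx-ClosedNbhdSub p2 2≤dcx v∈Ncx w∈Ncx

corollary5 : (n : ℕ) (G : Graph n) (d : Fin n → Fin n → ℕ) →
    Connected G → IsDistFun G d → P2 G d →
    (c₁ c₂ c x : Fin n) →
    ClosedNbhdSub G c₁ c₂ → 2 ≤ d c x → InNcx G d c x c₁ →
    InC G d c x c₂
corollary5 n G d _ isD p2 c₁ c₂ c x c₁⊆c₂ 2≤dcx c₁∈Ncx =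
  P2⇒InNcx⇒InC p2 2≤dcx (InNcx-ClosedNbhdSub 2≤dcx c₁∈Ncx c₁⊆c₂)
  where open Distance G d isD
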